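{- Let $G$ be the $n\times m$-grid with $2\le n\le m$, root $r=(0,0)$, unit demands and unit resistances, and let $\tilde T$ be a spanning tree of $G$ satisfying properties (S), (a), (b) below. Suppose there exists $k\in\{1,\dots,n+m-2\}$ with $s_k^{|V_k|}>2n$, and let $\beta$ be the maximum such $k$. Then $$\sum_{k=\beta+1}^{n+m-2} L_k(\tilde T)\le 4n^2m^2.$$
   Context: $V=\{(i,j):0\le i\le n-1,0\le j\le m-1\}$, edges join $(i,j),(i',j')$ with $|i-i'|+|j-j'|=1$. $V_k=\{(i,j)\in V:i+j=k\}$, $V_{\ge k}=\bigcup_{\ell\ge k}V_\ell$, and $E_k$ is the set of edges between $V_{k-1}$ and $V_k$. For a spanning tree $T=(V,F)$ and $e\in F$, $D_T(e)$ is the vertex set of the component of $T-e$ not containing $r$, and $L_k(T)=\sum_{e\in F\cap E_k}|D_T(e)|^2$. Regard $\tilde T$ as rooted at $r$; $\tilde T_v$ denotes the subtree consisting of $v$ and its descendants. Properties: (S) every vertex of $V_k$, $k\ge1$, has its parent in $V_{k-1}$; (a) for each $k\in\{n-1,\dots,m-1\}$ and each $v\in V_k$, $\tilde T_v$ is a path, and these $|V_k|$ paths have pairwise different lengths; (b) for each $k\in\{1,\dots,n-2\}$ exactly one vertex $z\in V_k$ has degree three in $\tilde T$, its two children are two vertices $v\in V_{k+1}$ whose subtrees $\tilde T_v$ have the minimum numbers of vertices among all $v\in V_{k+1}$, and all other vertices of $V_k$ have degree two in $\tilde T$. For each $k$, the vertices of $V_k$ are labeled $v_k^1,\dots,v_k^{|V_k|}$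 so that $s_k^1\le s_k^2\le\cdots\le s_k^{|V_k|}$, where $s_k^\ell=|V(\tilde T_{v_k^\ell})|$. -}

module Defs where

open import Data.Nat using (ℕ; zero; suc; _+_; _*_; _∸_; _^_; _≤_; _<_)
open import Data.Nat.Properties using (_≟_; _<?_)
open import Data.Product using (_×_; _,_; ∃; Σ)
open import Data.Product.Properties using (≡-dec)
open import Data.Sum using (_⊎_)
open import Data.List using (List; upTo; concatMap; map; filter; length)
open import Data.Nat.ListAction using (sum)
open import Data.List.Relation.Unary.Any using (Any; any?)
open import Relation.Nullary using (¬_; Dec; yes; no)
open import Relation.Nullary.Decidable using (_×-dec_; _⊎-dec_; ¬?)
open import Relation.Binary.PropositionalEquality using (_≡_; _≢_)
open import Relation.Binary.Definitions using (DecidableEquality)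

Vtx : Set
Vtx = ℕ × ℕ

_≟v_ : DecidableEquality Vtx
_≟v_ = ≡-dec _≟_ _≟_

InGrid : ℕ → ℕ → Vtx → Set
InGrid n m (i , j) = (i < n) × (j < m)

root : Vtx
root = (0 , 0)

-- level: v ∈ V_k iff level v ≡ k
level : Vtx → ℕ
level (i , j) = i + j

Adj : Vtx → Vtx → Set
Adj (i , j) (i' , j') =
  ((i ≡ i') × ((suc j ≡ j') ⊎ (suc j' ≡ j))) ⊎
  ((j ≡ j') × ((suc i ≡ i') ⊎ (suc i' ≡ i)))

verts : ℕ → ℕ → List Vtx
verts n m = concatMap (λ i → map (i ,_) (upTo m)) (upTo n)

step : (Vtx → Vtx) → Vtx → Vtx
step p v with v ≟v root
... | yes _ = root
... | no  _ = p v

anc : (Vtx → Vtx) → ℕ → Vtx → Vtx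
anc p zero    v = v
anc p (suc t) v = anc p t (step p v)

-- A spanning tree of the n × m grid, rooted at r, given by its parent map:
-- its edge set is F = { {v , parent v} : v ∈ V, v ≠ r }.
record SpanningTree (n m : ℕ) : Set where
  field
    parent     : Vtx → Vtx
    parent-in  : ∀ v → InGrid n m v → v ≢ root → InGrid n m (parent v)
    parent-adj : ∀ v → InGrid n m v → v ≢ root → Adj v (parent v)
    reaches    : ∀ v → InGrid n m v → ∃ λ t → anc parent t v ≡ root
open SpanningTree public

module _ {n m : ℕ} (T : SpanningTree n m) where

  private p = parent T

  -- u is a descendant of v (u ∈ V(T̃_v)), u = v allowed
  Desc : Vtx → Vtx → Set
  Desc u v = ∃ λ t → anc p t u ≡ v

  -- decidable version (a root path in a tree on n*m vertices has < n*m edges)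
  desc? : (u v : Vtx) → Dec (Any (λ t → anc p t u ≡ v) (upTo (suc (n * m))))
  desc? u v = any? (λ t → anc p t u ≟v v) (upTo (suc (n * m)))

  -- s(v) = |V(T̃_v)|; this is also |D_T(e)| for the tree edge e = {v , parent v}
  size : Vtx → ℕ
  size v = length (filter (λ u → desc? u v) (verts n m))

  len : Vtx → ℕ
  len v = size v ∸ 1

  Child : Vtx → Vtx → Set
  Child c z = InGrid n m c × (c ≢ root) × (p c ≡ z)

  nchild : Vtx → ℕ
  nchild z = length (filter (λ c → ¬? (c ≟v root) ×-dec (p c ≟v z)) (verts n m))

  deg : Vtx → ℕ
  deg z with z ≟v root
  ... | yes _ = nchild z
  ... | no  _ = suc (nchild z)

  inE? : (k : ℕ) (u w : Vtx) →
         Dec (((level u ≡ k) × (suc (level w) ≡ k)) ⊎ ((level w ≡ k) × (suc (level u) ≡ k)))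
  inE? k u w = ((level u ≟ k) ×-dec (suc (level w) ≟ k)) ⊎-dec ((level w ≟ k) ×-dec (suc (level u) ≟ k))

  L : ℕ → ℕ
  L k = sum (map (λ v → size v ^ 2)
                 (filter (λ v → ¬? (v ≟v root) ×-dec inE? k v (p v)) (verts n m)))

  sumL : ℕ → ℕ → ℕ
  sumL a b = sum (map (λ i → L (a + i)) (upTo (suc b ∸ a)))

  PropS : Set
  PropS = ∀ v → InGrid n m v → 1 ≤ level v → suc (level (p v)) ≡ level v

  PropA : Set
  PropA = ∀ k → n ∸ 1 ≤ k → k ≤ m ∸ 1 →
    (∀ v → InGrid n m v → level v ≡ k →
       ∀ u → InGrid n m u → Desc u v → nchild u ≤ 1)
    × (∀ v w → InGrid n m v → level v ≡ k → InGrid n m w → level w ≡ k →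
       v ≢ w → len v ≢ len w)

  PropB : Set
  PropB = ∀ k → 1 ≤ k → k ≤ n ∸ 2 →
    Σ Vtx λ z → InGrid n m z × level z ≡ k × deg z ≡ 3
      × (∀ z' → InGrid n m z' → level z' ≡ k → deg z' ≡ 3 → z' ≡ z)
      × (∀ z' → InGrid n m z' → level z' ≡ k → z' ≢ z → deg z' ≡ 2)
      × (∀ c → Child c z → level c ≡ suc k)
      × (∀ c → Child c z → ∀ w → InGrid n m w → level w ≡ suc k →
           ¬ Child w z → size c ≤ size w)

{-# OPTIONS --safe #-}
module Submission where

-- By (S), a tree edge {v , parent v} lying in E_k has its lower endpoint v in V_k, and
-- |D(e)| = s(v). For k > β maximality of β gives s(v) ≤ 2n, and every vertex is the lower
-- endpoint of at most one edge, so Σ_{k > β} L_k ≤ |V| (2n)² = 4n³m ≤ 4n²m².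

open import Defs
open import Data.Nat using (ℕ; zero; suc; _+_; _*_; _∸_; _^_; _≤_; _<_; z≤n; s≤s)
open import Data.Nat.Properties
open import Data.Nat.ListAction using (sum)
open import Data.Nat.Tactic.RingSolver using (solve-∀)
open import Data.Product using (_×_; Σ; _,_)
open import Data.Sum using (_⊎_; inj₁; inj₂)
open import Data.List using (List; []; _∷_; _++_; map; filter; upTo; length; concatMap)
open import Data.List.Properties using (length-++; length-map; length-upTo; map-cong; map-∘)
open import Data.List.Membership.Propositional using (_∈_; find)
open import Data.List.Membership.Propositional.Properties using (∈-upTo⁻; ∈-map⁻; ∈-concatMap⁻)
open import Data.List.Relation.Unary.All using (All; []; _∷_)
open import Data.List.Relation.Unary.Any using (here; there)
open import Data.List.Relation.Unary.Unique.Propositional using (Unique; []; _∷_)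
import Data.List.Relation.Unary.Unique.Propositional.Properties as Unique
open import Relation.Nullary using (yes; no; contradiction)
open import Level using (0ℓ)
open import Relation.Unary using (Pred; Decidable)
open import Relation.Binary.PropositionalEquality using (_≡_; _≢_; refl; sym; trans; cong; cong₂; subst; module ≡-Reasoning)

module _ {A : Set} where

  sum-map-mono : ∀ (f g : A → ℕ) xs → (∀ x → x ∈ xs → f x ≤ g x) →
                 sum (map f xs) ≤ sum (map g xs)
  sum-map-mono f g []       f≤g = z≤n
  sum-map-mono f g (x ∷ xs) f≤g =
    +-mono-≤ (f≤g x (here refl)) (sum-map-mono f g xs (λ y y∈ → f≤g y (there y∈)))

  sum-map-filter≤ : ∀ {P : Pred A 0ℓ} (P? : Decidable P) (f g : A → ℕ) xs →
                    (∀ x → x ∈ xs → P x → f x ≤ g x) →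
                    sum (map f (filter P? xs)) ≤ sum (map g xs)
  sum-map-filter≤ P? f g []       f≤g = z≤n
  sum-map-filter≤ P? f g (x ∷ xs) f≤g
    with P? x | sum-map-filter≤ P? f g xs (λ y y∈ → f≤g y (there y∈))
  ... | yes px | rest = +-mono-≤ (f≤g x (here refl) px) rest
  ... | no  _  | rest = ≤-trans rest (m≤n+m _ (g x))

  sum-map-const : ∀ c (xs : List A) → sum (map (λ _ → c) xs) ≡ length xs * c
  sum-map-const c []       = refl
  sum-map-const c (x ∷ xs) = cong (c +_) (sum-map-const c xs)

  sum-map-*ʳ : ∀ (f : A → ℕ) c xs → sum (map (λ x → f x * c) xs) ≡ sum (map f xs) * c
  sum-map-*ʳ f c []       = refl
  sum-map-*ʳ f c (x ∷ xs) =
    trans (cong (f x * c +_) (sum-map-*ʳ f c xs)) (sym (*-distribʳ-+ c (f x) _))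

  sum-map-+ : ∀ (f g : A → ℕ) xs →
              sum (map (λ x → f x + g x) xs) ≡ sum (map f xs) + sum (map g xs)
  sum-map-+ f g []       = refl
  sum-map-+ f g (x ∷ xs) =
    trans (cong (f x + g x +_) (sum-map-+ f g xs)) (+-interchange (f x) (g x) _ _)
    where
    +-interchange : ∀ a b c d → a + b + (c + d) ≡ a + c + (b + d)
    +-interchange = solve-∀

sum-map-comm : ∀ {A B : Set} (f : A → B → ℕ) xs ys →
               sum (map (λ x → sum (map (f x) ys)) xs) ≡ sum (map (λ y → sum (map (λ x → f x y) xs)) ys)
sum-map-comm f []       ys = sym (trans (sum-map-const 0 ys) (*-zeroʳ (length ys)))
sum-map-comm f (x ∷ xs) ys = begin
  sum (map (f x) ys) + sum (map (λ x → sum (map (f x) ys)) xs)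
    ≡⟨ cong (sum (map (f x) ys) +_) (sum-map-comm f xs ys) ⟩
  sum (map (f x) ys) + sum (map (λ y → sum (map (λ x → f x y) xs)) ys)
    ≡⟨ sum-map-+ (f x) (λ y → sum (map (λ x → f x y) xs)) ys ⟨
  sum (map (λ y → sum (map (λ x' → f x' y) (x ∷ xs))) ys) ∎
  where open ≡-Reasoning

δ : ℕ → ℕ → ℕ
δ k c with k ≟ c
... | yes _ = 1
... | no  _ = 0

δ-refl : ∀ k → δ k k ≡ 1
δ-refl k with k ≟ k
... | yes _ = refl
... | no k≢k = contradiction refl k≢k

δ-≢ : ∀ {k c} → c ≢ k → δ k c ≡ 0
δ-≢ {k} {c} c≢k with k ≟ c
... | yes k≡c = contradiction (sym k≡c) c≢k
... | no  _   = refl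

sum-δ≡0 : ∀ {c ks} → All (c ≢_) ks → sum (map (λ k → δ k c) ks) ≡ 0
sum-δ≡0 []           = refl
sum-δ≡0 (c≢k ∷ c≢ks) = cong₂ _+_ (δ-≢ c≢k) (sum-δ≡0 c≢ks)

sum-δ≤1 : ∀ {c ks} → Unique ks → sum (map (λ k → δ k c) ks) ≤ 1
sum-δ≤1 []                  = z≤n
sum-δ≤1 {c} {k ∷ ks} (k≢ks ∷ uniq) with k ≟ c
... | yes refl = ≤-reflexive (cong suc (sum-δ≡0 k≢ks))
... | no  _    = sum-δ≤1 uniq

∈-verts⁻ : ∀ {n m v} → v ∈ verts n m → InGrid n m v
∈-verts⁻ {n} {m} v∈
  with i , i∈ , v∈row ← find (∈-concatMap⁻ (λ i → map (i ,_) (upTo m)) {xs = upTo n} v∈)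
  with j , j∈ , refl ← ∈-map⁻ (i ,_) v∈row
  = ∈-upTo⁻ i∈ , ∈-upTo⁻ j∈

length-verts : ∀ n m → length (verts n m) ≡ n * m
length-verts n m = trans (rows (upTo n)) (cong (_* m) (length-upTo n))
  where
  rows : ∀ is → length (concatMap (λ i → map (i ,_) (upTo m)) is) ≡ length is * m
  rows []       = refl
  rows (i ∷ is) = begin
    length (map (i ,_) (upTo m) ++ concatMap (λ i → map (i ,_) (upTo m)) is)
      ≡⟨ length-++ (map (i ,_) (upTo m)) ⟩
    length (map (i ,_) (upTo m)) + length (concatMap (λ i → map (i ,_) (upTo m)) is)
      ≡⟨ cong₂ _+_ (trans (length-map (i ,_) (upTo m)) (length-upTo m)) (rows is) ⟩
    m + length is * m ∎
    where open ≡-Reasoning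

level≥1 : ∀ v → v ≢ root → 1 ≤ level v
level≥1 (zero  , zero)  v≢r = contradiction refl v≢r
level≥1 (zero  , suc j) v≢r = s≤s z≤n
level≥1 (suc i , j)     v≢r = s≤s z≤n

InE : ℕ → Vtx → Vtx → Set
InE k u w = (level u ≡ k × suc (level w) ≡ k) ⊎ (level w ≡ k × suc (level u) ≡ k)

module _ {n m} (T : SpanningTree n m) (propS : PropS T) where

  level≡-InE-parent : ∀ {k v} → InGrid n m v → v ≢ root → InE k v (parent T v) → level v ≡ k
  level≡-InE-parent _ _ (inj₁ (lv≡k , _)) = lv≡k
  level≡-InE-parent {v = v} v∈ v≢r (inj₂ (lp≡k , 1+lv≡k)) =
    contradiction (trans (sym 1+lp≡lv) (trans (cong suc lp≡k) (cong suc (sym 1+lv≡k))))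
                  (m≢1+n+m (level v) {1})
    where
    1+lp≡lv = propS v v∈ (level≥1 v v≢r)

  L≤sum-δ : ∀ k s → (∀ v → InGrid n m v → level v ≡ k → size T v ≤ s) →
            L T k ≤ sum (map (λ v → δ k (level v) * s ^ 2) (verts n m))
  L≤sum-δ k s small =
    sum-map-filter≤ _ (λ v → size T v ^ 2) (λ v → δ k (level v) * s ^ 2) (verts n m) bound
    where
    bound : ∀ v → v ∈ verts n m → v ≢ root × InE k v (parent T v) →
            size T v ^ 2 ≤ δ k (level v) * s ^ 2
    bound v v∈ (v≢r , e) = begin
      size T v ^ 2             ≤⟨ ^-monoˡ-≤ 2 (small v v∈G lv≡k) ⟩
      s ^ 2                    ≡⟨ *-identityˡ (s ^ 2) ⟨
      1 * s ^ 2                ≡⟨ cong (_* s ^ 2) (trans (cong (δ k) lv≡k) (δ-refl k)) ⟨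
      δ k (level v) * s ^ 2    ∎
      where
      open ≤-Reasoning
      v∈G  = ∈-verts⁻ v∈
      lv≡k = level≡-InE-parent v∈G v≢r e

  sum-map-L≤ : ∀ ks s → Unique ks →
               (∀ k → k ∈ ks → ∀ v → InGrid n m v → level v ≡ k → size T v ≤ s) →
               sum (map (L T) ks) ≤ n * m * s ^ 2
  sum-map-L≤ ks s uniq small = begin
    sum (map (L T) ks)
      ≤⟨ sum-map-mono (L T) _ ks (λ k k∈ → L≤sum-δ k s (small k k∈)) ⟩
    sum (map (λ k → sum (map (λ v → δ k (level v) * s ^ 2) vs)) ks)
      ≡⟨ sum-map-comm (λ k v → δ k (level v) * s ^ 2) ks vs ⟩
    sum (map (λ v → sum (map (λ k → δ k (level v) * s ^ 2) ks)) vs)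
      ≡⟨ cong sum (map-cong (λ v → sum-map-*ʳ (λ k → δ k (level v)) (s ^ 2) ks) vs) ⟩
    sum (map (λ v → sum (map (λ k → δ k (level v)) ks) * s ^ 2) vs)
      ≤⟨ sum-map-mono _ (λ _ → 1 * s ^ 2) vs (λ v _ → *-monoˡ-≤ (s ^ 2) (sum-δ≤1 uniq)) ⟩
    sum (map (λ _ → 1 * s ^ 2) vs)
      ≡⟨ sum-map-const (1 * s ^ 2) vs ⟩
    length vs * (1 * s ^ 2)
      ≡⟨ cong₂ _*_ (length-verts n m) (*-identityˡ (s ^ 2)) ⟩
    n * m * s ^ 2 ∎
    where
    open ≤-Reasoning
    vs = verts n m

n*m*[2n]²≤4n²m² : ∀ {n m} → n ≤ m → n * m * (2 * n) ^ 2 ≤ 4 * n ^ 2 * m ^ 2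
n*m*[2n]²≤4n²m² {n} {m} n≤m = begin
  n * m * (2 * n) ^ 2    ≡⟨ expanded n m ⟩
  4 * n ^ 2 * (n * m)    ≤⟨ *-monoʳ-≤ (4 * n ^ 2) (*-monoˡ-≤ m n≤m) ⟩
  4 * n ^ 2 * (m * m)    ≡⟨ cong (4 * n ^ 2 *_) (cong (m *_) (sym (*-identityʳ m))) ⟩
  4 * n ^ 2 * m ^ 2      ∎
  where
  open ≤-Reasoning
  -- the ring solver does not recognise ℕ's _^_, so the squares are unfolded
  expanded : ∀ x y → x * y * (2 * x * (2 * x * 1)) ≡ 4 * (x * (x * 1)) * (x * y)
  expanded = solve-∀

lemma2 : ∀ n m → 2 ≤ n → n ≤ m → (T : SpanningTree n m) →
    PropS T → PropA T → PropB T →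
    ∀ β → 1 ≤ β → β ≤ n + m ∸ 2 →
    (Σ Vtx λ v → InGrid n m v × level v ≡ β × 2 * n < size T v) →
    (∀ k → β < k → k ≤ n + m ∸ 2 → ∀ v → InGrid n m v → level v ≡ k →
       size T v ≤ 2 * n) →
    sumL T (suc β) (n + m ∸ 2) ≤ 4 * n ^ 2 * m ^ 2
lemma2 n m _ n≤m T propS _ _ β _ β≤b _ small = begin
  sumL T (suc β) b             ≡⟨ cong sum (map-∘ (upTo (b ∸ β))) ⟩
  sum (map (L T) levels)       ≤⟨ sum-map-L≤ T propS levels (2 * n) levels-unique small-above-β ⟩
  n * m * (2 * n) ^ 2          ≤⟨ n*m*[2n]²≤4n²m² n≤m ⟩
  4 * n ^ 2 * m ^ 2            ∎
  where
  open ≤-Reasoning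
  b = n + m ∸ 2
  levels = map (suc β +_) (upTo (b ∸ β))

  levels-unique : Unique levels
  levels-unique = Unique.map⁺ (+-cancelˡ-≡ (suc β) _ _) (Unique.upTo⁺ (b ∸ β))

  small-above-β : ∀ k → k ∈ levels → ∀ v → InGrid n m v → level v ≡ k → size T v ≤ 2 * n
  small-above-β k k∈ with i , i∈ , refl ← ∈-map⁻ (suc β +_) k∈ =
    small (suc β + i) (s≤s (m≤m+n β i))
          (subst (_≤ b) (cong suc (+-comm i β)) (m≤o∸n⇒m+n≤o (suc i) β≤b (∈-upTo⁻ i∈)))
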